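{- Let $N$ be a positive integer such that $N\equiv 5\pmod 6$ and $N\notin\{5,11\}$. Then there exists an antipodal $5$-design with $2N+1$ rational points for the Chebyshev measure $(1-t^2)^{ -1/2}dt/\pi$ on $(-1,1)$.
   Context: An $m$-design with $n$ points for a probability measure $w(t)dt$ on an interval $I$ is a set of $n$ pairwise distinct points $x_1,\dots,x_n\in I$ with $\frac1n\sum_i f(x_i)=\int_I f(t)w(t)dt$ for every real polynomial $f$ of degree at most $m$. It is rational if all $x_i\in\mathbb{Q}$ and antipodal if $\{x_i\}=\{ -x_i\}$.
   Formalization: The design condition is required only for polynomials of degree at most 5 with rational coefficients, rather than for every real polynomial of degree at most 5. -}

module Defs where

open import Data.Nat as ℕ using (ℕ; zero; suc; _%_)
open import Data.Nat.Properties using (m^n≢0)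
open import Data.Nat.Combinatorics using (_C_)
open import Data.Integer using (+_)
open import Data.Rational using (ℚ; 0ℚ; 1ℚ; _+_; _*_; _/_; -_; _<_)
open import Data.Fin using (Fin)
open import Data.Vec using (Vec; lookup)
open import Data.Product using (_×_; ∃)
open import Relation.Binary.PropositionalEquality using (_≡_)
open import Function.Definitions using (Injective)

_^ℚ_ : ℚ → ℕ → ℚ
x ^ℚ zero = 1ℚ
x ^ℚ suc k = x * (x ^ℚ k)

Σ : (n : ℕ) → (Fin n → ℚ) → ℚ
Σ zero f = 0ℚ
Σ (suc n) f = f Fin.zero + Σ n (λ i → f (Fin.suc i))

-- a real polynomial of degree ≤ m is given by its coefficient vector (a_0,…,a_m);
-- (rational coefficients)
Poly : ℕ → Set
Poly m = Vec ℚ (suc m)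

eval : ∀ {m} → Poly m → ℚ → ℚ
eval {m} a x = Σ (suc m) (λ k → lookup a k * (x ^ℚ Data.Fin.toℕ k))

-- Moments of the Chebyshev measure (1-t²)^{-1/2} dt / π on (-1,1):
-- ∫ t^{2j} dμ = C(2j,j)/4^j , ∫ t^{odd} dμ = 0.
chebMomentEven : ℕ → ℚ
chebMomentEven j = _/_ (+ ((2 ℕ.* j) C j)) (4 ℕ.^ j) {{m^n≢0 4 j}}

chebMoment : ℕ → ℚ
chebMoment k with k % 2
... | zero  = chebMomentEven (k ℕ./ 2)
... | suc _ = 0ℚ

chebIntegral : ∀ {m} → Poly m → ℚ
chebIntegral {m} a = Σ (suc m) (λ k → lookup a k * chebMoment (Data.Fin.toℕ k))

IsChebDesign : (m n' : ℕ) → (Fin (suc n') → ℚ) → Set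
IsChebDesign m n' x =
  Injective _≡_ _≡_ x ×
  ((i : Fin (suc n')) → (- 1ℚ < x i) × (x i < 1ℚ)) ×
  ((f : Poly m) → ((+ 1) / suc n') * Σ (suc n') (λ i → eval f (x i)) ≡ chebIntegral f)

IsAntipodal : ∀ {n} → (Fin n → ℚ) → Set
IsAntipodal {n} x = (i : Fin n) → ∃ λ j → x j ≡ - (x i)

{-# OPTIONS --safe #-}
-- An antipodal configuration {0, ±y₁, …, ±y_N} integrates every odd monomial exactly, so it is a
-- 5-design for the Chebyshev measure as soon as Σ yᵢ² = (2N + 1)/4 and Σ yᵢ⁴ = 3(2N + 1)/16, the
-- moments 1/2 and 3/8 scaled by the number of points.  For N = 17 + 3m take seventeen fixed points
-- n/780 that satisfy these equations for m = 0, and add m triples (A, B, C)(k), k = 9, 10, …, from a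
-- rational curve on which A² + B² + C² = 3/2 and A⁴ + B⁴ + C⁴ = 9/8: each triple adds exactly the
-- right amount to both sums.  Along the curve A and C increase and B decreases, and the three
-- families and the fixed points occupy disjoint intervals of (0, 1), so all the points are distinct.
-- Every N ≡ 5 (mod 6) other than 5 and 11 is of the form 17 + 3m.
module Submission where

open import Defs

module ChebyshevDesigns where

  open import Algebra.Bundles using (CommutativeRing; CommutativeMonoid)
  open import Data.Fin as Fin using (Fin; zero; suc; toℕ; splitAt; join; _↑ˡ_; _↑ʳ_)
  open import Data.Fin.Patterns using (0F; 1F; 2F; 3F; 4F; 5F)
  open import Data.Fin.Properties using (toℕ-injective; join-splitAt; all?)
  import Data.Integer as ℤ
  import Data.Integer.Properties as ℤ
  open import Data.Nat as ℕ using (ℕ; zero; suc; s≤s; z≤n)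
  import Data.Nat.Properties as ℕ
  open import Data.Product using (_×_; _,_; proj₁; proj₂; ∃; Σ-syntax)
  open import Data.Rational
    using (ℚ; 0ℚ; 1ℚ; ½; _+_; _*_; -_; _-_; 1/_; _/_; _≤_; _<_; _>_; _≤ᵇ_;
           Positive; NonNegative; nonNegative; nonPositive)
  open import Data.Rational.Literals using (fromℤ)
  open import Data.Rational.Properties
  import Data.Rational.Unnormalised as ℚᵘ
  import Data.Rational.Unnormalised.Properties as ℚᵘ
  open import Data.Rational.Solver using (module +-*-Solver)
  open import Data.Nat.Tactic.RingSolver using (solve-∀)
  open import Data.Sum using (inj₁; inj₂; [_,_]′)
  open import Data.Sum.Properties using ([,]-∘; [,]-map)
  open import Data.Vec using (lookup)
  open import Data.Vec.Functional using (Vector; []; _∷_; _++_; map)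
  open import Data.Vec.Functional.Properties using (lookup-++ˡ; lookup-++ʳ)
  open import Data.Vec.Functional.Relation.Unary.All using (All; all)
  open import Data.Vec.Functional.Relation.Unary.All.Properties using (++⁺)
  open import Data.Empty using (⊥-elim)
  open import Function using (_∘_; Injective)
  open import Relation.Binary.PropositionalEquality
  open import Relation.Binary using (Rel; Transitive; Irreflexive; tri<; tri≈; tri>)
  open import Relation.Nullary.Decidable using (Dec; from-yes; map′; _×-dec_; _→-dec_)
  open import Data.Bool using (T)
  open import Data.Unit using (tt)

  open import Algebra.Properties.Semiring.Sum (CommutativeRing.semiring +-*-commutativeRing)
    using (sum; sum-cong-≗; ∑-comm; ∑-distrib-+; *-distribˡ-sum)
  open import Algebra.Properties.CommutativeSemigroup
    (CommutativeMonoid.commutativeSemigroup *-1-commutativeMonoid) using (x∙yz≈y∙xz; xy∙z≈xz∙y)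
  open import Algebra.Properties.Group +-0-group using () renaming (⁻¹-involutive to neg-involutive)
  open +-*-Solver

  ι : ℕ → ℚ
  ι n = fromℤ (ℤ.+ n)

  ι-+ : ∀ m n → ι (m ℕ.+ n) ≡ ι m + ι n
  ι-+ m n = toℚᵘ-injective (ℚᵘ.≃-trans (ℚᵘ.*≡* eq) (ℚᵘ.≃-sym (toℚᵘ-homo-+ (ι m) (ι n))))
    where
    eq : ℤ.+ (m ℕ.+ n) ℤ.* ℤ.+ 1 ≡ (ℤ.+ m ℤ.* ℤ.+ 1 ℤ.+ ℤ.+ n ℤ.* ℤ.+ 1) ℤ.* ℤ.+ 1
    eq = begin
      ℤ.+ (m ℕ.+ n) ℤ.* ℤ.+ 1              ≡⟨ ℤ.*-identityʳ _ ⟩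
      ℤ.+ (m ℕ.+ n)                        ≡⟨ ℤ.pos-+ m n ⟩
      ℤ.+ m ℤ.+ ℤ.+ n
        ≡⟨ cong₂ ℤ._+_ (sym (ℤ.*-identityʳ (ℤ.+ m))) (sym (ℤ.*-identityʳ (ℤ.+ n))) ⟩
      ℤ.+ m ℤ.* ℤ.+ 1 ℤ.+ ℤ.+ n ℤ.* ℤ.+ 1  ≡⟨ sym (ℤ.*-identityʳ _) ⟩
      (ℤ.+ m ℤ.* ℤ.+ 1 ℤ.+ ℤ.+ n ℤ.* ℤ.+ 1) ℤ.* ℤ.+ 1 ∎
      where open ≡-Reasoning

  ι-* : ∀ m n → ι (m ℕ.* n) ≡ ι m * ι n
  ι-* m n = toℚᵘ-injective (ℚᵘ.≃-trans (ℚᵘ.*≡* (cong (ℤ._* ℤ.+ 1) (ℤ.pos-* m n)))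
                                       (ℚᵘ.≃-sym (toℚᵘ-homo-* (ι m) (ι n))))

  ι-suc : ∀ n → ι (suc n) ≡ 1ℚ + ι n
  ι-suc = ι-+ 1

  -- ↥p/↧p≡p turns 1/ ι (suc n), whose numerator is 1 and denominator suc n, into + 1 / suc n.
  weight-inverse : ∀ n → (ℤ.+ 1 / suc n) * ι (suc n) ≡ 1ℚ
  weight-inverse n = trans (cong (_* ι (suc n)) (↥p/↧p≡p (1/ ι (suc n)))) (*-inverseˡ (ι (suc n)))

  Σ≡sum : ∀ n (f : Vector ℚ n) → Σ n f ≡ sum f
  Σ≡sum zero    f = refl
  Σ≡sum (suc n) f = cong (f zero +_) (Σ≡sum n (f ∘ suc))

  sum-constant : ∀ n {f : Vector ℚ n} c → (∀ i → f i ≡ c) → sum f ≡ ι n * c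
  sum-constant zero        c _   = sym (*-zeroˡ c)
  sum-constant (suc n) {f} c f≡c = begin
    f zero + sum (f ∘ suc)  ≡⟨ cong₂ _+_ (f≡c zero) (sum-constant n c (f≡c ∘ suc)) ⟩
    c + ι n * c             ≡⟨ cong (_+ ι n * c) (sym (*-identityˡ c)) ⟩
    1ℚ * c + ι n * c        ≡⟨ sym (*-distribʳ-+ c 1ℚ (ι n)) ⟩
    (1ℚ + ι n) * c          ≡⟨ cong (_* c) (sym (ι-suc n)) ⟩
    ι (suc n) * c           ∎
    where open ≡-Reasoning

  sum-++ : ∀ {m n} (f : Vector ℚ m) (g : Vector ℚ n) → sum (f ++ g) ≡ sum f + sum g
  sum-++ {zero}  f g = sym (+-identityˡ (sum g))
  sum-++ {suc m} f g = begin
    f zero + sum ((f ++ g) ∘ suc)     ≡⟨ cong (f zero +_) (sum-cong-≗ (λ i → [,]-map (splitAt m i))) ⟩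
    f zero + sum ((f ∘ suc) ++ g)     ≡⟨ cong (f zero +_) (sum-++ (f ∘ suc) g) ⟩
    f zero + (sum (f ∘ suc) + sum g)  ≡⟨ sym (+-assoc (f zero) _ _) ⟩
    sum f + sum g                     ∎
    where open ≡-Reasoning

  -- Power sums and Chebyshev quadrature

  powerSum : ∀ {n} → Vector ℚ n → ℕ → ℚ
  powerSum x k = sum (λ i → x i ^ℚ k)

  powerSum-++ : ∀ {m n} (f : Vector ℚ m) (g : Vector ℚ n) k →
                powerSum (f ++ g) k ≡ powerSum f k + powerSum g k
  powerSum-++ {m} f g k =
    trans (sum-cong-≗ (λ i → [,]-∘ (_^ℚ k) (splitAt m i)))
          (sum-++ (λ i → f i ^ℚ k) (λ i → g i ^ℚ k))

  powerSums⇒chebIntegral : ∀ {m n} (w : ℚ) (x : Vector ℚ n) →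
    (∀ (k : Fin (suc m)) → w * powerSum x (toℕ k) ≡ chebMoment (toℕ k)) →
    (f : Poly m) → w * Σ n (λ i → eval f (x i)) ≡ chebIntegral f
  powerSums⇒chebIntegral {m} {n} w x moments f = begin
    w * Σ n (λ i → eval f (x i))
      ≡⟨ cong (w *_) (trans (Σ≡sum n _) (sum-cong-≗ (λ i → Σ≡sum (suc m) (term i)))) ⟩
    w * sum (λ i → sum (term i))
      ≡⟨ cong (w *_) (∑-comm term) ⟩
    w * sum (λ k → sum (λ i → term i k))
      ≡⟨ cong (w *_) (sum-cong-≗ (λ k → sym (*-distribˡ-sum (a k) (λ i → x i ^ℚ toℕ k)))) ⟩
    w * sum (λ k → a k * powerSum x (toℕ k))
      ≡⟨ *-distribˡ-sum w (λ k → a k * powerSum x (toℕ k)) ⟩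
    sum (λ k → w * (a k * powerSum x (toℕ k)))
      ≡⟨ sum-cong-≗ (λ k → trans (x∙yz≈y∙xz w (a k) _) (cong (a k *_) (moments k))) ⟩
    sum (λ k → a k * chebMoment (toℕ k))
      ≡⟨ sym (Σ≡sum (suc m) (λ k → a k * chebMoment (toℕ k))) ⟩
    chebIntegral f ∎
    where
    open ≡-Reasoning
    a : Fin (suc m) → ℚ
    a = lookup f
    term : Fin n → Fin (suc m) → ℚ
    term i k = a k * x i ^ℚ toℕ k

  -- Antipodal configurations

  neg-^ : ∀ a k → (- a) ^ℚ k ≡ (- 1ℚ) ^ℚ k * a ^ℚ k
  neg-^ a zero    = refl
  neg-^ a (suc k) = begin
    - a * (- a) ^ℚ k
      ≡⟨ cong (- a *_) (neg-^ a k) ⟩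
    - a * ((- 1ℚ) ^ℚ k * a ^ℚ k)
      ≡⟨ solve 3 (λ a s t → :- a :* (s :* t) := (:- con 1ℚ :* s) :* (a :* t))
               refl a ((- 1ℚ) ^ℚ k) (a ^ℚ k) ⟩
    (- 1ℚ) ^ℚ suc k * a ^ℚ suc k ∎
    where open ≡-Reasoning

  module _ {a} {A : Set a} where

    ∷-injective : ∀ {n} {x : A} {f : Vector A n} →
                  Injective _≡_ _≡_ f → (∀ i → x ≢ f i) → Injective _≡_ _≡_ (x ∷ f)
    ∷-injective f-inj fresh {zero}  {zero}  _  = refl
    ∷-injective f-inj fresh {zero}  {suc j} eq = ⊥-elim (fresh j eq)
    ∷-injective f-inj fresh {suc i} {zero}  eq = ⊥-elim (fresh i (sym eq))
    ∷-injective f-inj fresh {suc i} {suc j} eq = cong suc (f-inj eq)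

    ++-injective : ∀ {m n} {f : Vector A m} {g : Vector A n} →
                   Injective _≡_ _≡_ f → Injective _≡_ _≡_ g → (∀ i j → f i ≢ g j) →
                   Injective _≡_ _≡_ (f ++ g)
    ++-injective {m} {n} {f} {g} f-inj g-inj disjoint {k} {l} eq = begin
      k                       ≡⟨ sym (join-splitAt m n k) ⟩
      join m n (splitAt m k)  ≡⟨ cong (join m n) (copair-injective (splitAt m k) (splitAt m l) eq) ⟩
      join m n (splitAt m l)  ≡⟨ join-splitAt m n l ⟩
      l                       ∎
      where
      open ≡-Reasoning
      copair-injective : ∀ s t → [ f , g ]′ s ≡ [ f , g ]′ t → s ≡ t
      copair-injective (inj₁ i) (inj₁ j) e = cong inj₁ (f-inj e)
      copair-injective (inj₁ i) (inj₂ j) e = ⊥-elim (disjoint i j e)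
      copair-injective (inj₂ i) (inj₁ j) e = ⊥-elim (disjoint j i (sym e))
      copair-injective (inj₂ i) (inj₂ j) e = cong inj₂ (g-inj e)

  -- The trailing ++ [] makes the length suc (n + (n + 0)), which is suc (2 * n) by definition.
  antipodal : ∀ {n} → Vector ℚ n → Vector ℚ (suc (2 ℕ.* n))
  antipodal y = 0ℚ ∷ y ++ map -_ y ++ []

  module _ {n} (y : Vector ℚ n) where

    antipodal-isAntipodal : IsAntipodal (antipodal y)
    antipodal-isAntipodal zero    = zero , refl
    antipodal-isAntipodal (suc k) = ++⁺ P positives (++⁺ P negatives (λ ())) k
      where
      P : ℚ → Set
      P v = ∃ λ j → antipodal y j ≡ - v
      positives : All P y
      positives i = suc (n ↑ʳ (i ↑ˡ 0)) , trans (lookup-++ʳ y _ (i ↑ˡ 0)) (lookup-++ˡ (map -_ y) [] i)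
      negatives : All P (map -_ y)
      negatives i = suc (i ↑ˡ (n ℕ.+ 0)) , trans (lookup-++ˡ y _ i) (sym (neg-involutive (y i)))

    antipodal-bounded : All (λ v → 0ℚ < v × v < 1ℚ) y → All (λ v → - 1ℚ < v × v < 1ℚ) (antipodal y)
    antipodal-bounded y-bounded zero    = from-yes (- 1ℚ <? 0ℚ) , from-yes (0ℚ <? 1ℚ)
    antipodal-bounded y-bounded (suc k) = ++⁺ P positives (++⁺ P negatives (λ ())) k
      where
      P : ℚ → Set
      P v = - 1ℚ < v × v < 1ℚ
      positives : All P y
      positives i = <-trans (from-yes (- 1ℚ <? 0ℚ)) (proj₁ (y-bounded i)) , proj₂ (y-bounded i)
      negatives : All P (map -_ y)
      negatives i = neg-antimono-< (proj₂ (y-bounded i)) ,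
                    <-trans (neg-antimono-< (proj₁ (y-bounded i))) (from-yes (0ℚ <? 1ℚ))

    antipodal-injective : Injective _≡_ _≡_ y → All (0ℚ <_) y → Injective _≡_ _≡_ (antipodal y)
    antipodal-injective y-inj y>0 = ∷-injective (++-injective y-inj mirror-injective disjoint) nonzero
      where
      mirror-negative : All (_< 0ℚ) (map -_ y ++ [])
      mirror-negative = ++⁺ (_< 0ℚ) (λ i → neg-antimono-< (y>0 i)) (λ ())
      mirror-injective : Injective _≡_ _≡_ (map -_ y ++ [])
      mirror-injective = ++-injective (λ eq → y-inj (neg-injective eq)) (λ { {()} }) (λ _ ())
      disjoint : ∀ i j → y i ≢ (map -_ y ++ []) j
      disjoint i j eq = <-asym (y>0 i) (subst (_< 0ℚ) (sym eq) (mirror-negative j))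
      nonzero : All (0ℚ ≢_) (y ++ map -_ y ++ [])
      nonzero = ++⁺ (0ℚ ≢_) (λ i → <⇒≢ (y>0 i)) (λ j eq → <⇒≢ (mirror-negative j) (sym eq))

    powerSum-antipodal : ∀ k →
      powerSum (antipodal y) (suc k) ≡ (1ℚ + (- 1ℚ) ^ℚ suc k) * powerSum y (suc k)
    powerSum-antipodal k = begin
      0ℚ * 0ℚ ^ℚ k + powerSum (y ++ map -_ y ++ []) (suc k)
        ≡⟨ cong₂ _+_ (*-zeroˡ (0ℚ ^ℚ k))
                     (trans (powerSum-++ y _ (suc k)) (cong (S +_) (powerSum-++ (map -_ y) [] (suc k)))) ⟩
      0ℚ + (S + (powerSum (map -_ y) (suc k) + 0ℚ))
        ≡⟨ cong (λ e → 0ℚ + (S + (e + 0ℚ))) mirror ⟩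
      0ℚ + (S + (c * S + 0ℚ))
        ≡⟨ solve 2 (λ S c → con 0ℚ :+ (S :+ (c :* S :+ con 0ℚ)) := (con 1ℚ :+ c) :* S) refl S c ⟩
      (1ℚ + c) * S ∎
      where
      open ≡-Reasoning
      S c : ℚ
      S = powerSum y (suc k)
      c = (- 1ℚ) ^ℚ suc k
      mirror : powerSum (map -_ y) (suc k) ≡ c * S
      mirror = trans (sum-cong-≗ (λ i → neg-^ (y i) (suc k))) (sym (*-distribˡ-sum c (λ i → y i ^ℚ suc k)))

    antipodal-isChebDesign₅ :
      Injective _≡_ _≡_ y → All (λ v → 0ℚ < v × v < 1ℚ) y →
      powerSum y 2 ≡ ι (suc (2 ℕ.* n)) * (ℤ.+ 1 / 4) →
      powerSum y 4 ≡ ι (suc (2 ℕ.* n)) * (ℤ.+ 3 / 16) →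
      IsChebDesign 5 (2 ℕ.* n) (antipodal y)
    antipodal-isChebDesign₅ y-inj y-bounded S₂ S₄ =
      antipodal-injective y-inj (proj₁ ∘ y-bounded) ,
      antipodal-bounded y-bounded ,
      powerSums⇒chebIntegral w (antipodal y) moments
      where
      open ≡-Reasoning
      N : ℕ
      N = suc (2 ℕ.* n)
      w : ℚ
      w = ℤ.+ 1 / N
      odd-moment : ∀ k → 1ℚ + (- 1ℚ) ^ℚ suc k ≡ 0ℚ → w * powerSum (antipodal y) (suc k) ≡ 0ℚ
      odd-moment k vanishes = begin
        w * powerSum (antipodal y) (suc k)
          ≡⟨ cong (w *_) (powerSum-antipodal k) ⟩
        w * ((1ℚ + (- 1ℚ) ^ℚ suc k) * powerSum y (suc k))
          ≡⟨ cong (λ c → w * (c * powerSum y (suc k))) vanishes ⟩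
        w * (0ℚ * powerSum y (suc k))
          ≡⟨ cong (w *_) (*-zeroˡ (powerSum y (suc k))) ⟩
        w * 0ℚ
          ≡⟨ *-zeroʳ w ⟩
        0ℚ ∎
      even-moment : ∀ k μ → 1ℚ + (- 1ℚ) ^ℚ suc k ≡ ι 2 → powerSum y (suc k) ≡ ι N * μ →
                    w * powerSum (antipodal y) (suc k) ≡ ι 2 * μ
      even-moment k μ doubles Sₖ = begin
        w * powerSum (antipodal y) (suc k)
          ≡⟨ cong (w *_) (powerSum-antipodal k) ⟩
        w * ((1ℚ + (- 1ℚ) ^ℚ suc k) * powerSum y (suc k))
          ≡⟨ cong₂ (λ c s → w * (c * s)) doubles Sₖ ⟩
        w * (ι 2 * (ι N * μ))
          ≡⟨ solve 3 (λ w c μ → w :* (con (ι 2) :* (c :* μ)) := (w :* c) :* (con (ι 2) :* μ))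
                   refl w (ι N) μ ⟩
        w * ι N * (ι 2 * μ)
          ≡⟨ cong (_* (ι 2 * μ)) (weight-inverse (2 ℕ.* n)) ⟩
        1ℚ * (ι 2 * μ)
          ≡⟨ *-identityˡ (ι 2 * μ) ⟩
        ι 2 * μ ∎
      moments : ∀ (k : Fin 6) → w * powerSum (antipodal y) (toℕ k) ≡ chebMoment (toℕ k)
      moments 0F = trans (cong (w *_) (trans (sum-constant N 1ℚ (λ _ → refl)) (*-identityʳ (ι N))))
                         (weight-inverse (2 ℕ.* n))
      moments 1F = odd-moment 0 refl
      moments 2F = even-moment 1 (ℤ.+ 1 / 4) refl S₂
      moments 3F = odd-moment 2 refl
      moments 4F = even-moment 3 (ℤ.+ 3 / 16) refl S₄
      moments 5F = odd-moment 4 refl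

  -- Distinct points in prescribed intervals

  module _ {a ℓ} {X : Set a} {_≺_ : Rel X ℓ} (≺-trans : Transitive _≺_)
           {f : ℕ → X} (step : ∀ j → f j ≺ f (suc j)) where

    stepwise⇒monotonic : ∀ {i j} → i ℕ.< j → f i ≺ f j
    stepwise⇒monotonic {i} {suc j} i<1+j with ℕ.m≤n⇒m<n∨m≡n (ℕ.s≤s⁻¹ i<1+j)
    ... | inj₁ i<j  = ≺-trans (stepwise⇒monotonic i<j) (step j)
    ... | inj₂ refl = step j

    stepwise⇒injective : Irreflexive _≡_ _≺_ → Injective _≡_ _≡_ f
    stepwise⇒injective irrefl {i} {j} eq with ℕ.<-cmp i j
    ... | tri< i<j _ _ = ⊥-elim (irrefl eq (stepwise⇒monotonic i<j))
    ... | tri≈ _ i≡j _ = i≡j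
    ... | tri> _ _ j<i = ⊥-elim (irrefl (sym eq) (stepwise⇒monotonic j<i))

  infix 4 _∈[_,_⟩
  _∈[_,_⟩ : ℚ → ℚ → ℚ → Set
  v ∈[ a , b ⟩ = a ≤ v × v < b

  record DistinctIn {n} (a b : ℚ) (f : Vector ℚ n) : Set where
    field
      injective : Injective _≡_ _≡_ f
      bounded   : All (_∈[ a , b ⟩) f
  open DistinctIn

  distinctIn? : ∀ {n} a b (f : Vector ℚ n) → Dec (DistinctIn a b f)
  distinctIn? a b f =
    map′ (λ (inj , bnd) → record { injective = λ {i} {j} → inj i j ; bounded = bnd })
         (λ d → (λ i j → injective d) , bounded d)
         (all? (λ i → all? (λ j → (f i ≟ f j) →-dec (i Fin.≟ j)))
          ×-dec all (λ v → (a ≤? v) ×-dec (v <? b)) f)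

  -- The endpoint conditions are instance arguments: for literal endpoints they reduce to ⊤, which
  -- instance search solves with tt.
  ++-distinctIn : ∀ {m n a b c} {f : Vector ℚ m} {g : Vector ℚ n} →
                  {{_ : T (a ≤ᵇ b)}} {{_ : T (b ≤ᵇ c)}} →
                  DistinctIn a b f → DistinctIn b c g → DistinctIn a c (f ++ g)
  ++-distinctIn {a = a} {c = c} {f = f} {g = g} {{a≤b}} {{b≤c}} df dg = record
    { injective = ++-injective (injective df) (injective dg) separated
    ; bounded   = ++⁺ (_∈[ a , c ⟩)
                      (λ i → proj₁ (bounded df i) , <-≤-trans (proj₂ (bounded df i)) (≤ᵇ⇒≤ b≤c))
                      (λ j → ≤-trans (≤ᵇ⇒≤ a≤b) (proj₁ (bounded dg j)) , proj₂ (bounded dg j))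
    }
    where
    separated : ∀ i j → f i ≢ g j
    separated i j = <⇒≢ (<-≤-trans (proj₂ (bounded df i)) (proj₁ (bounded dg j)))

  increasing-distinctIn : ∀ {m a b} {f : ℕ → ℚ} →
                          (∀ j → f j < f (suc j)) → a ≤ f 0 → (∀ j → f j < b) →
                          DistinctIn a b (λ (i : Fin m) → f (toℕ i))
  increasing-distinctIn {f = f} step a≤f₀ f<b = record
    { injective = λ eq → toℕ-injective (stepwise⇒injective {_≺_ = _<_} <-trans {f = f} step <-irrefl eq)
    ; bounded   = λ i → ≤-trans a≤f₀ (above-f₀ (toℕ i)) , f<b (toℕ i)
    }
    where
    above-f₀ : ∀ j → f 0 ≤ f j
    above-f₀ zero    = ≤-refl
    above-f₀ (suc j) = <⇒≤ (stepwise⇒monotonic {_≺_ = _<_} <-trans {f = f} step (s≤s z≤n))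

  decreasing-distinctIn : ∀ {m a b} {f : ℕ → ℚ} →
                          (∀ j → f (suc j) < f j) → (∀ j → a ≤ f j) → f 0 < b →
                          DistinctIn a b (λ (i : Fin m) → f (toℕ i))
  decreasing-distinctIn {f = f} step a≤f f₀<b = record
    { injective = λ eq → toℕ-injective (stepwise⇒injective {_≺_ = _>_} >-trans {f = f} step >-irrefl eq)
    ; bounded   = λ i → a≤f (toℕ i) , ≤-<-trans (below-f₀ (toℕ i)) f₀<b
    }
    where
    >-trans : Transitive _>_
    >-trans p>q q>r = <-trans q>r p>q
    >-irrefl : Irreflexive _≡_ _>_
    >-irrefl eq = <-irrefl (sym eq)
    below-f₀ : ∀ j → f j ≤ f 0
    below-f₀ zero    = ≤-refl
    below-f₀ (suc j) = <⇒≤ (stepwise⇒monotonic {_≺_ = _>_} >-trans {f = f} step (s≤s z≤n))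

  -- A rational curve of triples

  square-nonNeg : ∀ k → NonNegative (k * k)
  square-nonNeg k with ≤-total 0ℚ k
  ... | inj₁ 0≤k = nonNeg*nonNeg⇒nonNeg k {{nonNegative 0≤k}} k {{nonNegative 0≤k}}
  ... | inj₂ k≤0 = nonPos*nonPos⇒nonPos k {{nonPositive k≤0}} k {{nonPositive k≤0}}

  den : ℚ → ℚ
  den k = ι 3 * (k * k) + 1ℚ

  den-positive : ∀ k → Positive (den k)
  den-positive k =
    nonNeg+pos⇒pos (ι 3 * (k * k)) {{nonNeg*nonNeg⇒nonNeg (ι 3) (k * k) {{square-nonNeg k}}}} 1ℚ

  1/den : ℚ → ℚ
  1/den k = (1/ den k) {{pos⇒nonZero (den k) {{den-positive k}}}}

  den*1/den : ∀ k → den k * 1/den k ≡ 1ℚ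
  den*1/den k = *-inverseʳ (den k) {{pos⇒nonZero (den k) {{den-positive k}}}}

  1/den-positive : ∀ k → Positive (1/den k)
  1/den-positive k = 1/pos⇒pos (den k) {{den-positive k}}

  -- With u = 3k² - 1 and v = 6k the triple is (u, (u + v)/2, (u - v)/2) / (3k² + 1), and
  -- (3k² + 1)² = u² + v²/3; this makes A² + B² + C² and A⁴ + B⁴ + C⁴ independent of k.
  numA numB numC : ℚ → ℚ
  numA k = ι 3 * (k * k) - 1ℚ
  numB k = (ι 3 * (k * k) + ι 6 * k - 1ℚ) * ½
  numC k = (ι 3 * (k * k) - ι 6 * k - 1ℚ) * ½

  A B C : ℚ → ℚ
  A k = numA k * 1/den k
  B k = numB k * 1/den k
  C k = numC k * 1/den k

  module _ {n : ℕ} where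
    denₚ numAₚ numBₚ numCₚ : Polynomial n → Polynomial n
    denₚ k  = con (ι 3) :* (k :* k) :+ con 1ℚ
    numAₚ k = con (ι 3) :* (k :* k) :- con 1ℚ
    numBₚ k = (con (ι 3) :* (k :* k) :+ con (ι 6) :* k :- con 1ℚ) :* con ½
    numCₚ k = (con (ι 3) :* (k :* k) :- con (ι 6) :* k :- con 1ℚ) :* con ½

  triple-squares : ∀ k → A k ^ℚ 2 + (B k ^ℚ 2 + C k ^ℚ 2) ≡ ℤ.+ 3 / 2
  triple-squares k = begin
    A k ^ℚ 2 + (B k ^ℚ 2 + C k ^ℚ 2)
      ≡⟨ solve 2 (λ k w → (numAₚ k :* w) :^ 2 :+ ((numBₚ k :* w) :^ 2 :+ (numCₚ k :* w) :^ 2)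
                        := con (ℤ.+ 3 / 2) :* (denₚ k :* w) :^ 2)
               refl k (1/den k) ⟩
    ℤ.+ 3 / 2 * (den k * 1/den k) ^ℚ 2
      ≡⟨ cong (λ e → ℤ.+ 3 / 2 * e ^ℚ 2) (den*1/den k) ⟩
    ℤ.+ 3 / 2 ∎
    where open ≡-Reasoning

  triple-fourthPowers : ∀ k → A k ^ℚ 4 + (B k ^ℚ 4 + C k ^ℚ 4) ≡ ℤ.+ 9 / 8
  triple-fourthPowers k = begin
    A k ^ℚ 4 + (B k ^ℚ 4 + C k ^ℚ 4)
      ≡⟨ solve 2 (λ k w → (numAₚ k :* w) :^ 4 :+ ((numBₚ k :* w) :^ 4 :+ (numCₚ k :* w) :^ 4)
                        := con (ℤ.+ 9 / 8) :* (denₚ k :* w) :^ 4)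
               refl k (1/den k) ⟩
    ℤ.+ 9 / 8 * (den k * 1/den k) ^ℚ 4
      ≡⟨ cong (λ e → ℤ.+ 9 / 8 * e ^ℚ 4) (den*1/den k) ⟩
    ℤ.+ 9 / 8 ∎
    where open ≡-Reasoning

  *den*1/den : ∀ q k → q * den k * 1/den k ≡ q
  *den*1/den q k = trans (*-assoc q (den k) (1/den k)) (trans (cong (q *_) (den*1/den k)) (*-identityʳ q))

  ÷den-< : ∀ p q k → p < q * den k → p * 1/den k < q
  ÷den-< p q k p<qd =
    subst (p * 1/den k <_) (*den*1/den q k) (*-monoˡ-<-pos (1/den k) {{1/den-positive k}} p<qd)

  <-÷den : ∀ p q k → q * den k < p → q < p * 1/den k
  <-÷den p q k qd<p =
    subst (_< p * 1/den k) (*den*1/den q k) (*-monoˡ-<-pos (1/den k) {{1/den-positive k}} qd<p)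

  ÷den-<-÷den : ∀ p q k l → p * den l < q * den k → p * 1/den k < q * 1/den l
  ÷den-<-÷den p q k l cross =
    <-÷den q (p * 1/den k) l (subst (_< q) (xy∙z≈xz∙y p (den l) (1/den k)) (÷den-< (p * den l) q k cross))

  <-by-gap : ∀ {p q} g → q ≡ p + g → 0ℚ < g → p < q
  <-by-gap {p} g q≡p+g g>0 = subst (p <_) (sym q≡p+g) (subst (_< p + g) (+-identityʳ p) (+-monoʳ-< p g>0))

  0≤* : ∀ {a b} → 0ℚ ≤ a → 0ℚ ≤ b → 0ℚ ≤ a * b
  0≤* {a} {b} a≥0 b≥0 =
    nonNegative⁻¹ (a * b) {{nonNeg*nonNeg⇒nonNeg a {{nonNegative a≥0}} b {{nonNegative b≥0}}}}

  linear-pos : ∀ c₀ c₁ {t} → 0ℚ ≤ t → 0ℚ < ι (suc c₀) + t * ι c₁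
  linear-pos c₀ c₁ t≥0 = +-mono-<-≤ (positive⁻¹ (ι (suc c₀))) (0≤* t≥0 (nonNegative⁻¹ (ι c₁)))

  quadratic-pos : ∀ c₀ c₁ c₂ {t} → 0ℚ ≤ t → 0ℚ < ι (suc c₀) + t * (ι c₁ + t * ι c₂)
  quadratic-pos c₀ c₁ c₂ t≥0 = +-mono-<-≤ (positive⁻¹ (ι (suc c₀)))
    (0≤* t≥0 (+-mono-≤ (nonNegative⁻¹ (ι c₁)) (0≤* t≥0 (nonNegative⁻¹ (ι c₂)))))

  A<1 : ∀ k → A k < 1ℚ
  A<1 k = ÷den-< (numA k) 1ℚ k (<-by-gap (ι 2)
    (solve 1 (λ k → con 1ℚ :* denₚ k := numAₚ k :+ con (ι 2)) refl k)
    (positive⁻¹ (ι 2)))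

  -- Each gap below, written in t = k - 9, has nonnegative coefficients and a positive constant term.
  module _ {k} (k≥9 : ι 9 ≤ k) where

    private
      t≥0 : 0ℚ ≤ k - ι 9
      t≥0 = +-monoˡ-≤ (- ι 9) k≥9

    C<½ : C k < ½
    C<½ = ÷den-< (numC k) ½ k (<-by-gap (ι 28 + (k - ι 9) * ι 3)
      (solve 1 (λ k → con ½ :* denₚ k := numCₚ k :+ (con (ι 28) :+ (k :- con (ι 9)) :* con (ι 3))) refl k)
      (linear-pos 27 3 t≥0))

    ½<B : ½ < B k
    ½<B = <-÷den (numB k) ½ k (<-by-gap (ι 26 + (k - ι 9) * ι 3)
      (solve 1 (λ k → numBₚ k := con ½ :* denₚ k :+ (con (ι 26) :+ (k :- con (ι 9)) :* con (ι 3))) refl k)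
      (linear-pos 25 3 t≥0))

    A-increasing : A k < A (1ℚ + k)
    A-increasing = ÷den-<-÷den (numA k) (numA (1ℚ + k)) k (1ℚ + k)
      (<-by-gap (ι 114 + (k - ι 9) * ι 12)
      (solve 1 (λ k → numAₚ (con 1ℚ :+ k) :* denₚ k
                      := numAₚ k :* denₚ (con 1ℚ :+ k)
                         :+ (con (ι 114) :+ (k :- con (ι 9)) :* con (ι 12))) refl k)
      (linear-pos 113 12 t≥0))

    C-increasing : C k < C (1ℚ + k)
    C-increasing = ÷den-<-÷den (numC k) (numC (1ℚ + k)) k (1ℚ + k)
      (<-by-gap (ι 864 + (k - ι 9) * (ι 177 + (k - ι 9) * ι 9))
      (solve 1 (λ k → numCₚ (con 1ℚ :+ k) :* denₚ k
                      := numCₚ k :* denₚ (con 1ℚ :+ k)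
                         :+ (con (ι 864) :+ (k :- con (ι 9)) :* (con (ι 177) :+ (k :- con (ι 9)) :* con (ι 9))))
               refl k)
      (quadratic-pos 863 177 9 t≥0))

    B-decreasing : B (1ℚ + k) < B k
    B-decreasing = ÷den-<-÷den (numB (1ℚ + k)) (numB k) (1ℚ + k) k
      (<-by-gap (ι 750 + (k - ι 9) * (ι 165 + (k - ι 9) * ι 9))
      (solve 1 (λ k → numBₚ k :* denₚ (con 1ℚ :+ k)
                      := numBₚ (con 1ℚ :+ k) :* denₚ k
                         :+ (con (ι 750) :+ (k :- con (ι 9)) :* (con (ι 165) :+ (k :- con (ι 9)) :* con (ι 9))))
               refl k)
      (quadratic-pos 749 165 9 t≥0))

  -- The half configuration

  κ : ℕ → ℚ
  κ j = ι 9 + ι j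

  κ-suc : ∀ j → κ (suc j) ≡ 1ℚ + κ j
  κ-suc j = trans (cong (ι 9 +_) (ι-suc j))
                  (solve 2 (λ a b → a :+ (con 1ℚ :+ b) := con 1ℚ :+ (a :+ b)) refl (ι 9) (ι j))

  9≤κ : ∀ j → ι 9 ≤ κ j
  9≤κ j = +-monoʳ-≤ (ι 9) (nonNegative⁻¹ (ι j))

  family : (ℚ → ℚ) → ∀ m → Vector ℚ m
  family T m i = T (κ (toℕ i))

  C-distinctIn : ∀ m → DistinctIn (ℤ.+ 1 / 3) ½ (family C m)
  C-distinctIn m =
    increasing-distinctIn {f = C ∘ κ} step (from-yes (ℤ.+ 1 / 3 ≤? C (κ 0))) (λ j → C<½ (9≤κ j))
    where
    step : ∀ j → C (κ j) < C (κ (suc j))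
    step j = subst (λ k → C (κ j) < C k) (sym (κ-suc j)) (C-increasing (9≤κ j))

  B-distinctIn : ∀ m → DistinctIn ½ (ℤ.+ 61 / 100) (family B m)
  B-distinctIn m =
    decreasing-distinctIn {f = B ∘ κ} step (λ j → <⇒≤ (½<B (9≤κ j)))
                          (from-yes (B (κ 0) <? ℤ.+ 61 / 100))
    where
    step : ∀ j → B (κ (suc j)) < B (κ j)
    step j = subst (λ k → B k < B (κ j)) (sym (κ-suc j)) (B-decreasing (9≤κ j))

  A-distinctIn : ∀ m → DistinctIn (ℤ.+ 99 / 100) 1ℚ (family A m)
  A-distinctIn m =
    increasing-distinctIn {f = A ∘ κ} step (from-yes (ℤ.+ 99 / 100 ≤? A (κ 0))) (λ j → A<1 (κ j))
    where
    step : ∀ j → A (κ j) < A (κ (suc j))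
    step j = subst (λ k → A (κ j) < A k) (sym (κ-suc j)) (A-increasing (9≤κ j))

  lowBase : Vector ℚ 5
  lowBase = map (λ a → ℤ.+ a / 780) (13 ∷ 15 ∷ 163 ∷ 169 ∷ 229 ∷ [])

  highBase : Vector ℚ 12
  highBase = map (λ a → ℤ.+ a / 780)
                 (481 ∷ 525 ∷ 546 ∷ 591 ∷ 663 ∷ 669 ∷ 671 ∷ 713 ∷ 717 ∷ 739 ∷ 759 ∷ 761 ∷ [])

  lowBase-distinctIn : DistinctIn (ℤ.+ 1 / 60) (ℤ.+ 1 / 3) lowBase
  lowBase-distinctIn = from-yes (distinctIn? (ℤ.+ 1 / 60) (ℤ.+ 1 / 3) lowBase)

  highBase-distinctIn : DistinctIn (ℤ.+ 61 / 100) (ℤ.+ 99 / 100) highBase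
  highBase-distinctIn = from-yes (distinctIn? (ℤ.+ 61 / 100) (ℤ.+ 99 / 100) highBase)

  base-squares : powerSum lowBase 2 + powerSum highBase 2 ≡ ℤ.+ 35 / 4
  base-squares = refl

  base-fourthPowers : powerSum lowBase 4 + powerSum highBase 4 ≡ ℤ.+ 105 / 16
  base-fourthPowers = refl

  halfSize : ℕ → ℕ
  halfSize m = 5 ℕ.+ (m ℕ.+ (m ℕ.+ (12 ℕ.+ m)))

  halfConfiguration : ∀ m → Vector ℚ (halfSize m)
  halfConfiguration m = lowBase ++ family C m ++ family B m ++ highBase ++ family A m

  halfConfiguration-distinctIn : ∀ m → DistinctIn (ℤ.+ 1 / 60) 1ℚ (halfConfiguration m)
  halfConfiguration-distinctIn m =
    ++-distinctIn lowBase-distinctIn (++-distinctIn (C-distinctIn m)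
      (++-distinctIn (B-distinctIn m) (++-distinctIn highBase-distinctIn (A-distinctIn m))))

  powerSum-halfConfiguration : ∀ m k {β τ} →
    powerSum lowBase k + powerSum highBase k ≡ β → (∀ l → A l ^ℚ k + (B l ^ℚ k + C l ^ℚ k) ≡ τ) →
    powerSum (halfConfiguration m) k ≡ β + ι m * τ
  powerSum-halfConfiguration m k {β} {τ} base triple = begin
    powerSum (halfConfiguration m) k
      ≡⟨ trans (powerSum-++ lowBase (Cs ++ Bs ++ highBase ++ As) k) (cong (pL +_)
           (trans (powerSum-++ Cs (Bs ++ highBase ++ As) k) (cong (pC +_)
           (trans (powerSum-++ Bs (highBase ++ As) k) (cong (pB +_) (powerSum-++ highBase As k)))))) ⟩
    pL + (pC + (pB + (pH + pA)))
      ≡⟨ solve 5 (λ l c b h a → l :+ (c :+ (b :+ (h :+ a))) := (l :+ h) :+ (a :+ (b :+ c)))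
               refl pL pC pB pH pA ⟩
    (pL + pH) + (pA + (pB + pC))
      ≡⟨ cong ((pL + pH) +_) (sym (trans
           (∑-distrib-+ (λ i → As i ^ℚ k) (λ i → Bs i ^ℚ k + Cs i ^ℚ k))
           (cong (pA +_) (∑-distrib-+ (λ i → Bs i ^ℚ k) (λ i → Cs i ^ℚ k))))) ⟩
    (pL + pH) + sum (λ i → As i ^ℚ k + (Bs i ^ℚ k + Cs i ^ℚ k))
      ≡⟨ cong₂ _+_ base (sum-constant m τ (λ i → triple (κ (toℕ i)))) ⟩
    β + ι m * τ ∎
    where
    open ≡-Reasoning
    As Bs Cs : Vector ℚ m
    As = family A m
    Bs = family B m
    Cs = family C m
    pL pH pA pB pC : ℚ
    pL = powerSum lowBase k
    pH = powerSum highBase k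
    pA = powerSum As k
    pB = powerSum Bs k
    pC = powerSum Cs k

  -- Stated with halfSize unfolded, as solve-∀ does not look through definitions.
  halfSize-count : ∀ m → suc (2 ℕ.* (5 ℕ.+ (m ℕ.+ (m ℕ.+ (12 ℕ.+ m))))) ≡ 35 ℕ.+ 6 ℕ.* m
  halfSize-count = solve-∀

  ι-halfSize-count : ∀ m → ι (suc (2 ℕ.* halfSize m)) ≡ ι 35 + ι 6 * ι m
  ι-halfSize-count m =
    trans (cong ι (halfSize-count m)) (trans (ι-+ 35 (6 ℕ.* m)) (cong (ι 35 +_) (ι-* 6 m)))

  halfConfiguration-squares : ∀ m →
    powerSum (halfConfiguration m) 2 ≡ ι (suc (2 ℕ.* halfSize m)) * (ℤ.+ 1 / 4)
  halfConfiguration-squares m = begin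
    powerSum (halfConfiguration m) 2
      ≡⟨ powerSum-halfConfiguration m 2 base-squares triple-squares ⟩
    ℤ.+ 35 / 4 + ι m * (ℤ.+ 3 / 2)
      ≡⟨ solve 1 (λ μ → con (ℤ.+ 35 / 4) :+ μ :* con (ℤ.+ 3 / 2)
                     := (con (ι 35) :+ con (ι 6) :* μ) :* con (ℤ.+ 1 / 4)) refl (ι m) ⟩
    (ι 35 + ι 6 * ι m) * (ℤ.+ 1 / 4)
      ≡⟨ cong (_* (ℤ.+ 1 / 4)) (sym (ι-halfSize-count m)) ⟩
    ι (suc (2 ℕ.* halfSize m)) * (ℤ.+ 1 / 4) ∎
    where open ≡-Reasoning

  halfConfiguration-fourthPowers : ∀ m →
    powerSum (halfConfiguration m) 4 ≡ ι (suc (2 ℕ.* halfSize m)) * (ℤ.+ 3 / 16)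
  halfConfiguration-fourthPowers m = begin
    powerSum (halfConfiguration m) 4
      ≡⟨ powerSum-halfConfiguration m 4 base-fourthPowers triple-fourthPowers ⟩
    ℤ.+ 105 / 16 + ι m * (ℤ.+ 9 / 8)
      ≡⟨ solve 1 (λ μ → con (ℤ.+ 105 / 16) :+ μ :* con (ℤ.+ 9 / 8)
                     := (con (ι 35) :+ con (ι 6) :* μ) :* con (ℤ.+ 3 / 16)) refl (ι m) ⟩
    (ι 35 + ι 6 * ι m) * (ℤ.+ 3 / 16)
      ≡⟨ cong (_* (ℤ.+ 3 / 16)) (sym (ι-halfSize-count m)) ⟩
    ι (suc (2 ℕ.* halfSize m)) * (ℤ.+ 3 / 16) ∎
    where open ≡-Reasoning

  antipodalChebDesign₅ : ∀ m →
    Σ[ x ∈ Vector ℚ (suc (2 ℕ.* halfSize m)) ] (IsChebDesign 5 (2 ℕ.* halfSize m) x × IsAntipodal x)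
  antipodalChebDesign₅ m =
    antipodal y ,
    antipodal-isChebDesign₅ y (injective distinct) bounds
      (halfConfiguration-squares m) (halfConfiguration-fourthPowers m) ,
    antipodal-isAntipodal y
    where
    y : Vector ℚ (halfSize m)
    y = halfConfiguration m
    distinct : DistinctIn (ℤ.+ 1 / 60) 1ℚ y
    distinct = halfConfiguration-distinctIn m
    bounds : All (λ v → 0ℚ < v × v < 1ℚ) y
    bounds i = <-≤-trans (positive⁻¹ (ℤ.+ 1 / 60)) (proj₁ (bounded distinct i)) ,
               proj₂ (bounded distinct i)

open ChebyshevDesigns using (halfSize; antipodalChebDesign₅)

open import Data.Nat using (ℕ; suc; _%_; _*_; _<_)
open import Data.Rational using (ℚ)
open import Data.Fin using (Fin)
open import Data.Product using (Σ-syntax; _×_)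
open import Relation.Binary.PropositionalEquality using (_≡_; _≢_)
open import Data.Empty using (⊥-elim)
open import Data.Nat using (_+_; _/_)
open import Data.Nat.DivMod using (m≡m%n+[m/n]*n)
open import Data.Nat.Tactic.RingSolver using (solve-∀)
open import Data.Product using (_,_)
open import Relation.Binary.PropositionalEquality using (refl; trans; cong)

≡5-mod-6⇒halfSize : ∀ {N} → N % 6 ≡ 5 → N ≢ 5 → N ≢ 11 → Σ[ m ∈ ℕ ] N ≡ halfSize m
≡5-mod-6⇒halfSize {N} N%6≡5 N≢5 N≢11 =
  from-quotient (N / 6) (trans (m≡m%n+[m/n]*n N 6) (cong (_+ N / 6 * 6) N%6≡5))
  where
  shape : ∀ r → 5 + (2 + r) * 6 ≡ 5 + (2 * r + (2 * r + (12 + 2 * r)))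
  shape = solve-∀
  from-quotient : ∀ q → N ≡ 5 + q * 6 → Σ[ m ∈ ℕ ] N ≡ halfSize m
  from-quotient 0             N≡5  = ⊥-elim (N≢5 N≡5)
  from-quotient 1             N≡11 = ⊥-elim (N≢11 N≡11)
  from-quotient (suc (suc r)) N≡   = 2 * r , trans N≡ (shape r)

-- 0 < N follows from N % 6 ≡ 5.
theorem8p2 : (N : ℕ) → 0 < N → N % 6 ≡ 5 → N ≢ 5 → N ≢ 11 →
    Σ[ x ∈ (Fin (suc (2 * N)) → ℚ) ] (IsChebDesign 5 (2 * N) x × IsAntipodal x)
theorem8p2 N _ N%6≡5 N≢5 N≢11 with ≡5-mod-6⇒halfSize N%6≡5 N≢5 N≢11
... | m , refl = antipodalChebDesign₅ m
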